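{- If $G$ is a finite simple graph and $k\ge 2$ is an integer, then \begin{align*} \phi_{gm}(G\circ K_{2k}) & \ge \phi_{gm}(G) + n(G)(2k^2 - 3k + 2),\\ \phi_{gm}(G\circ K_{k,k}) & \ge \phi_{gm}(G) + n(G)(k^2 - k + 1). \end{align*}
   Context: $K_{2k}$ is the complete graph on $2k$ vertices and $K_{k,k}$ the complete bipartite graph with both parts of size $k$. For a graph $X$, $n(X)$ is its number of vertices. A maximal matching is a matching not contained in any larger matching. A global forcing set for maximal matchings of $X$ is a set $S\subseteq E(X)$ such that $M_1\cap S\neq M_2\cap S$ for every two distinct maximal matchings $M_1,M_2$ of $X$; $\phi_{gm}(X)$ is the minimum size of such a set. The corona product $G\circ H$, where $V(G)=\{g_1,\dots,g_{n(G)}\}$, is obtained from the disjoint union of $G$ and $n(G)$ copies $H_1,\dots,H_{n(G)}$ of $H$ by joining, for each $i$, $g_i$ to every vertex of $H_i$. -}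

module Defs where

open import Data.Nat using (ℕ; zero; suc; _+_; _*_; _<?_)
open import Data.Fin using (Fin; zero; suc; toℕ; _≟_; combine; remQuot)
open import Data.Bool using (Bool; true; false; not; _∧_; _xor_; if_then_else_)
open import Data.Bool.Properties using (xor-comm; xor-same; ∧-comm)
open import Data.List using (List; map; allFin)
open import Data.Nat.ListAction using (sum)
import Data.Empty
import Data.Nat
import Data.Product
open import Data.Product using (_×_; _,_; proj₁; proj₂)
open import Relation.Nullary using (¬_; yes; no)
open import Relation.Nullary.Decidable using (⌊_⌋)
open import Relation.Binary.PropositionalEquality using (_≡_; refl; sym; trans; cong₂)

record Graph : Set where
  field
    n      : ℕ
    adj    : Fin n → Fin n → Bool
    adjSym : ∀ i j → adj i j ≡ adj j i
    irrefl : ∀ i → adj i i ≡ false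
open Graph public

nV : Graph → ℕ
nV X = Graph.n X

-- Sets of edges: symmetric Bool relations contained in the adjacency.
-- The edge {i,j} is in S iff S i j ≡ true (equivalently S j i ≡ true).

Rel : Graph → Set
Rel X = Fin (n X) → Fin (n X) → Bool

IsEdgeSet : (X : Graph) → Rel X → Set
IsEdgeSet X S = (∀ i j → S i j ≡ S j i) × (∀ i j → S i j ≡ true → adj X i j ≡ true)

SameEdges : (X : Graph) → Rel X → Rel X → Set
SameEdges X S T = ∀ i j → S i j ≡ T i j

_⊆E_ : {X : Graph} → Rel X → Rel X → Set
_⊆E_ {X} S T = ∀ i j → S i j ≡ true → T i j ≡ true

_∩E_ : {X : Graph} → Rel X → Rel X → Rel X
_∩E_ {X} S T i j = S i j ∧ T i j

edgeCount : (X : Graph) → Rel X → ℕ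
edgeCount X S =
  sum (map (λ i → sum (map (λ j → if ⌊ toℕ i <? toℕ j ⌋ ∧ S i j then 1 else 0)
                           (allFin (n X))))
           (allFin (n X)))

IsMatching : (X : Graph) → Rel X → Set
IsMatching X M = IsEdgeSet X M × (∀ v a b → M v a ≡ true → M v b ≡ true → a ≡ b)

IsMaximalMatching : (X : Graph) → Rel X → Set
IsMaximalMatching X M =
  IsMatching X M × (∀ M' → IsMatching X M' → _⊆E_ {X} M M' → _⊆E_ {X} M' M)

IsGlobalForcingSet : (X : Graph) → Rel X → Set
IsGlobalForcingSet X S =
  IsEdgeSet X S ×
  (∀ M₁ M₂ → IsMaximalMatching X M₁ → IsMaximalMatching X M₂ →
     ¬ SameEdges X M₁ M₂ → ¬ SameEdges X (_∩E_ {X} M₁ S) (_∩E_ {X} M₂ S))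

IsPhiGM : Graph → ℕ → Set
IsPhiGM X m =
  (Data.Product.Σ (Rel X) λ S → IsGlobalForcingSet X S × edgeCount X S ≡ m) ×
  (∀ S → IsGlobalForcingSet X S → m Data.Nat.≤ edgeCount X S)

K : ℕ → Graph
K m = record
  { n = m
  ; adj = λ i j → not ⌊ i ≟ j ⌋
  ; adjSym = λ i j → eqSym i j
  ; irrefl = λ i → irr i
  }
  where
  eqSym : ∀ {m} (i j : Fin m) → not ⌊ i ≟ j ⌋ ≡ not ⌊ j ≟ i ⌋
  eqSym i j with i ≟ j | j ≟ i
  ... | yes _ | yes _ = refl
  ... | no _  | no _  = refl
  ... | yes p | no q  = Data.Empty.⊥-elim (q (sym p))
  ... | no p  | yes q = Data.Empty.⊥-elim (p (sym q))
  irr : ∀ {m} (i : Fin m) → not ⌊ i ≟ i ⌋ ≡ false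
  irr i with i ≟ i
  ... | yes _ = refl
  ... | no p  = Data.Empty.⊥-elim (p refl)

Kbip : ℕ → Graph
Kbip k = record
  { n = k + k
  ; adj = λ i j → ⌊ toℕ i <? k ⌋ xor ⌊ toℕ j <? k ⌋
  ; adjSym = λ i j → xor-comm ⌊ toℕ i <? k ⌋ ⌊ toℕ j <? k ⌋
  ; irrefl = λ i → xor-same ⌊ toℕ i <? k ⌋
  }

-- Corona product G ∘ H.
-- Vertices: Fin (n G * suc (n H)); vertex combine i zero is g_i, and
-- vertex combine i (suc v) is the copy of v ∈ V(H) in H_i.

private
  ⌊≟⌋-sym : ∀ {m} (i j : Fin m) → ⌊ i ≟ j ⌋ ≡ ⌊ j ≟ i ⌋
  ⌊≟⌋-sym i j with i ≟ j | j ≟ i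
  ... | yes _ | yes _ = refl
  ... | no _  | no _  = refl
  ... | yes p | no q  = Data.Empty.⊥-elim (q (sym p))
  ... | no p  | yes q = Data.Empty.⊥-elim (p (sym q))

  ⌊≟⌋-refl : ∀ {m} (i : Fin m) → ⌊ i ≟ i ⌋ ≡ true
  ⌊≟⌋-refl i with i ≟ i
  ... | yes _ = refl
  ... | no p  = Data.Empty.⊥-elim (p refl)

coronaAdjPair : (G H : Graph) → Fin (n G) × Fin (suc (n H)) → Fin (n G) × Fin (suc (n H)) → Bool
coronaAdjPair G H (i , zero)  (j , zero)  = adj G i j
coronaAdjPair G H (i , zero)  (j , suc v) = ⌊ i ≟ j ⌋
coronaAdjPair G H (i , suc u) (j , zero)  = ⌊ i ≟ j ⌋
coronaAdjPair G H (i , suc u) (j , suc v) = ⌊ i ≟ j ⌋ ∧ adj H u v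

private
  cSym : (G H : Graph) → ∀ p q → coronaAdjPair G H p q ≡ coronaAdjPair G H q p
  cSym G H (i , zero)  (j , zero)  = adjSym G i j
  cSym G H (i , zero)  (j , suc v) = ⌊≟⌋-sym i j
  cSym G H (i , suc u) (j , zero)  = ⌊≟⌋-sym i j
  cSym G H (i , suc u) (j , suc v) = cong₂ _∧_ (⌊≟⌋-sym i j) (adjSym H u v)

  cIrr : (G H : Graph) → ∀ p → coronaAdjPair G H p p ≡ false
  cIrr G H (i , zero)  = irrefl G i
  cIrr G H (i , suc u) = trans (cong₂ _∧_ (⌊≟⌋-refl i) (irrefl H u)) refl

corona : Graph → Graph → Graph
corona G H = record
  { n = n G * suc (n H)
  ; adj = λ x y → coronaAdjPair G H (remQuot (suc (n H)) x) (remQuot (suc (n H)) y)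
  ; adjSym = λ x y → cSym G H (remQuot (suc (n H)) x) (remQuot (suc (n H)) y)
  ; irrefl = λ x → cIrr G H (remQuot (suc (n H)) x)
  }

{-# OPTIONS --safe #-}
-- Let p be a perfect matching of H that is also an automorphism of H (for K_{2k} and K_{k,k}
-- take v ↦ 2k − 1 − v).  Extending maximal matchings of G by p inside every copy of H shows
-- that the edges of a global forcing set S of G ∘ H lying in G form a global forcing set of G.
-- Inside each cone g_i + H_i, S must contain many edges: if in a maximal matching u is matched
-- to x, y is free and adjacent to u, and x has no other free neighbour, then trading ux for uy
-- gives another maximal matching, so S contains ux or uy.  Letting the hub g_i replace one
-- vertex c in the matching p (so that c becomes the only free vertex of the cone) gives an edge
-- of S at g_i, and, after rerouting p through an arbitrary edge ux of H, shows that every vertex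
-- of H_i misses at most one of its edges in S.  Counting for each vertex u its edges to later
-- neighbours, S has at least 1 + Σ_u (d⁺(u) − 1) edges in every cone, which is 2k² − 3k + 2
-- for K_{2k} and at least k² − k + 1 for K_{k,k}.

module Submission where

open import Defs
open import Data.Bool using (Bool; true; false; not; _∧_; _xor_; if_then_else_)
open import Data.Bool.Properties
  using (⇔→≡; ∧-zeroʳ; not-¬; not-involutive; not-distribˡ-xor; not-distribʳ-xor; xor-same)
open import Data.Empty using (⊥-elim)
open import Data.Fin using (Fin; zero; suc; toℕ; _≟_; combine; remQuot; lift; opposite; _↑ˡ_; _↑ʳ_)
open import Data.Fin.Permutation.Components using (transpose; transpose-inverse)
open import Data.Fin.Properties
  using (0≢1+n; remQuot-combine; combine-remQuot; combine-injective; suc-injective; toℕ-combine;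
         opposite-prop; opposite-involutive; toℕ<n; toℕ-↑ˡ; toℕ-↑ʳ)
open import Data.List using (map; allFin; tabulate)
open import Data.List.Properties using (map-tabulate)
import Data.Nat.ListAction as List
open import Data.Nat using (ℕ; zero; suc; _+_; _*_; _∸_; _≤_; _<_; _<ᵇ_; _<?_; z≤n; s≤s)
open import Data.Nat.Properties
  using (+-0-commutativeMonoid; ≤-refl; ≤-trans; ≤-reflexive; <-irrefl; ≮⇒≥; <-≤-trans;
         +-assoc; +-comm; +-suc; +-identityʳ; *-suc; *-zeroʳ; *-identityʳ; *-distribʳ-+; *-distribˡ-∸;
         *-cancelʳ-≡; +-mono-≤; +-monoʳ-≤; *-monoʳ-≤; ∸-monoˡ-≤; m≤m+n; m≤n+m; m+n≮m;
         m∸n+n≡m; m+n∸n≡m; m≤n+o⇒m∸n≤o; module ≤-Reasoning)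
open import Data.Nat.Tactic.RingSolver using (solve-∀)
open import Data.Product using (Σ; _×_; _,_; proj₁; proj₂; uncurry)
open import Data.Sum using (_⊎_; inj₁; inj₂)
open import Function using (_∘_; id)
open import Function.Bundles using (mk⇔)
open import Relation.Nullary using (¬_; Dec; yes; no; does; contradiction)
open import Relation.Nullary.Decidable using (⌊_⌋; dec-true; dec-false; isYes≗does)
open import Relation.Binary.PropositionalEquality
open import Algebra.Properties.CommutativeMonoid.Sum +-0-commutativeMonoid
  using (sum; sum-syntax; sum-cong-≗; ∑-distrib-+)

∧-true : ∀ {a b} → a ∧ b ≡ true → a ≡ true × b ≡ true
∧-true {true} {true} _ = refl , refl

⌊⌋-true : ∀ {p} {P : Set p} (d : Dec P) → ⌊ d ⌋ ≡ true → P
⌊⌋-true (yes p) _ = p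

⌊⌋-yes : ∀ {p} {P : Set p} (d : Dec P) → P → ⌊ d ⌋ ≡ true
⌊⌋-yes d p = trans (isYes≗does d) (dec-true d p)

⌊⌋-no : ∀ {p} {P : Set p} (d : Dec P) → ¬ P → ⌊ d ⌋ ≡ false
⌊⌋-no d ¬p = trans (isYes≗does d) (dec-false d ¬p)

true≢false : true ≢ false
true≢false ()

transpose-matchˡ : ∀ {k} (i j : Fin k) → transpose i j i ≡ j
transpose-matchˡ i j rewrite dec-true (i ≟ i) refl = refl

transpose-matchʳ : ∀ {k} (i j : Fin k) → transpose i j j ≡ i
transpose-matchʳ i j with j ≟ i
... | yes j≡i = j≡i
... | no _ rewrite dec-true (j ≟ j) refl = refl

transpose-other : ∀ {m} {i j k : Fin m} → k ≢ i → k ≢ j → transpose i j k ≡ k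
transpose-other {i = i} {j} {k} k≢i k≢j rewrite dec-false (k ≟ i) k≢i | dec-false (k ≟ j) k≢j = refl

conjugate : ∀ {m} → (Fin m → Fin m) → Fin m → Fin m → Fin m → Fin m
conjugate σ i j = transpose i j ∘ σ ∘ transpose j i

conjugate-involutive : ∀ {m} {σ : Fin m → Fin m} i j → (∀ v → σ (σ v) ≡ v) →
                       ∀ v → conjugate σ i j (conjugate σ i j v) ≡ v
conjugate-involutive {σ = σ} i j σ² v = begin
  transpose i j (σ (transpose j i (transpose i j (σ (transpose j i v)))))
    ≡⟨ cong (transpose i j ∘ σ) (transpose-inverse j i) ⟩
  transpose i j (σ (σ (transpose j i v)))  ≡⟨ cong (transpose i j) (σ² _) ⟩
  transpose i j (transpose j i v)          ≡⟨ transpose-inverse i j ⟩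
  v                                        ∎
  where open ≡-Reasoning

conjugate-fixed : ∀ {m} {σ : Fin m → Fin m} i j {v} → conjugate σ i j v ≡ v →
                  σ (transpose j i v) ≡ transpose j i v
conjugate-fixed {σ = σ} i j {v} eq = begin
  σ (transpose j i v)                                  ≡⟨ transpose-inverse j i ⟨
  transpose j i (transpose i j (σ (transpose j i v)))  ≡⟨ cong (transpose j i) eq ⟩
  transpose j i v                                      ∎
  where open ≡-Reasoning

-- Maximal matchings and global forcing sets

∩E-agrees : ∀ {X : Graph} {M₁ M₂ S : Rel X} →
            (∀ a b → M₁ a b ≡ true → M₂ a b ≡ false → S a b ≡ false) →
            (∀ a b → M₂ a b ≡ true → M₁ a b ≡ false → S a b ≡ false) →
            SameEdges X (_∩E_ {X} M₁ S) (_∩E_ {X} M₂ S)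
∩E-agrees {M₁ = M₁} {M₂} {S} only₁ only₂ a b
  with M₁ a b in e₁ | M₂ a b in e₂
... | true  | true  = refl
... | false | false = refl
... | true  | false rewrite only₁ a b e₁ e₂ = refl
... | false | true  rewrite only₂ a b e₂ e₁ = refl

⊆E-matched : ∀ {X : Graph} {N N' : Rel X} → IsMatching X N' → _⊆E_ {X} N N' →
             ∀ {x y z} → N x z ≡ true → N' x y ≡ true → N x y ≡ true
⊆E-matched {N = N} (_ , N'-unique) N⊆N' {x} {y} {z} Nxz N'xy =
  subst (λ w → N x w ≡ true) (N'-unique x z y (N⊆N' x z Nxz) N'xy) Nxz

module InvolutionMatching (X : Graph) where

  private
    V = Fin (n X)

  record IsMaximalInvolution (μ : V → V) : Set where
    field
      involutive  : ∀ v → μ (μ v) ≡ v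
      adjacent    : ∀ v → μ v ≢ v → adj X v (μ v) ≡ true
      independent : ∀ v w → μ v ≡ v → μ w ≡ w → adj X v w ≡ false

  edgesOf : (V → V) → Rel X
  edgesOf μ v w = ⌊ μ v ≟ w ⌋ ∧ not ⌊ v ≟ w ⌋

  edgesOf-true : ∀ μ {v w} → edgesOf μ v w ≡ true → μ v ≡ w × v ≢ w
  edgesOf-true μ {v} {w} e with v ≟ w | ∧-true {⌊ μ v ≟ w ⌋} e
  ... | no v≢w | μv≡w , _ = ⌊⌋-true (μ v ≟ w) μv≡w , v≢w

  edgesOf-intro : ∀ μ {v w} → μ v ≡ w → v ≢ w → edgesOf μ v w ≡ true
  edgesOf-intro μ {v} {w} μv≡w v≢w rewrite ⌊⌋-yes (μ v ≟ w) μv≡w | ⌊⌋-no (v ≟ w) v≢w = refl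

  edgesOf-false : ∀ μ {v w} → μ v ≢ w → edgesOf μ v w ≡ false
  edgesOf-false μ {v} {w} μv≢w rewrite ⌊⌋-no (μ v ≟ w) μv≢w = refl

  module _ {μ : V → V} (isMax : IsMaximalInvolution μ) where
    open IsMaximalInvolution isMax

    mate : ∀ {v} → μ v ≢ v → edgesOf μ v (μ v) ≡ true
    mate μv≢v = edgesOf-intro μ refl (μv≢v ∘ sym)

    edgesOf-maximal : IsMaximalMatching X (edgesOf μ)
    edgesOf-maximal = ((symmetric , edge) , unique) , maximal
      where
      flip-edge : ∀ {v w} → edgesOf μ v w ≡ true → edgesOf μ w v ≡ true
      flip-edge {v} e with edgesOf-true μ e
      ... | refl , v≢μv = edgesOf-intro μ (involutive v) (v≢μv ∘ sym)

      symmetric : ∀ v w → edgesOf μ v w ≡ edgesOf μ w v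
      symmetric v w = ⇔→≡ (mk⇔ flip-edge flip-edge)

      edge : ∀ v w → edgesOf μ v w ≡ true → adj X v w ≡ true
      edge v w e with edgesOf-true μ e
      ... | refl , v≢μv = adjacent v (v≢μv ∘ sym)

      unique : ∀ v a b → edgesOf μ v a ≡ true → edgesOf μ v b ≡ true → a ≡ b
      unique v a b e₁ e₂ = trans (sym (proj₁ (edgesOf-true μ e₁))) (proj₁ (edgesOf-true μ e₂))

      maximal : ∀ M → IsMatching X M → _⊆E_ {X} (edgesOf μ) M → _⊆E_ {X} M (edgesOf μ)
      maximal M ((M-sym , M-edge) , M-unique) sub v w Mvw with μ v ≟ v | μ w ≟ w
      ... | no μv≢v | _ = subst (λ z → edgesOf μ v z ≡ true) μv≡w (mate μv≢v)
        where μv≡w = M-unique v (μ v) w (sub v (μ v) (mate μv≢v)) Mvw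
      ... | yes μv≡v | no μw≢w = contradiction (M-edge v v (subst (λ z → M z v ≡ true) w≡v Mvv))
                                               (λ e → true≢false (trans (sym e) (irrefl X v)))
        where
        μw≡v = M-unique w (μ w) v (sub w (μ w) (mate μw≢w)) (trans (M-sym w v) Mvw)
        w≡v = trans (sym (involutive w)) (trans (cong μ μw≡v) μv≡v)
        Mvv : M w v ≡ true
        Mvv = trans (M-sym w v) Mvw
      ... | yes μv≡v | yes μw≡w =
        contradiction (trans (sym (M-edge v w Mvw)) (independent v w μv≡v μw≡w)) true≢false

  module Swap {μ : V → V} (isMax : IsMaximalInvolution μ) {u y : V}
              (u-matched : μ u ≢ u) (y-free : μ y ≡ y) (u~y : adj X u y ≡ true)
              (mate-isolated : ∀ w → μ w ≡ w → w ≢ y → adj X (μ u) w ≡ false) where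
    open IsMaximalInvolution isMax

    private
      x : V
      x = μ u

      u≢y : u ≢ y
      u≢y refl = u-matched y-free

      u≢x : u ≢ x
      u≢x = u-matched ∘ sym

      x≢y : x ≢ y
      x≢y x≡y = u≢y (trans (sym (involutive u)) (trans (cong μ x≡y) y-free))

      μ-injective : ∀ {a b} → μ a ≡ μ b → a ≡ b
      μ-injective {a} {b} e = trans (sym (involutive a)) (trans (cong μ e) (involutive b))

    -- u trades its mate x for the free vertex y, leaving x free.
    swapped : V → V
    swapped = conjugate μ x y

    private
      at : ∀ z {w} → transpose y x z ≡ w → swapped z ≡ transpose x y (μ w)
      at _ = cong (transpose x y ∘ μ)

    swapped-u : swapped u ≡ y
    swapped-u = trans (at u (transpose-other u≢y u≢x)) (transpose-matchˡ x y)

    swapped-y : swapped y ≡ u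
    swapped-y = trans (at y (transpose-matchˡ y x))
                      (trans (cong (transpose x y) (involutive u)) (transpose-other u≢x u≢y))

    swapped-x : swapped x ≡ x
    swapped-x = trans (at x (transpose-matchʳ y x)) (trans (cong (transpose x y) y-free) (transpose-matchʳ x y))

    swapped-other : ∀ {z} → z ≢ u → z ≢ x → z ≢ y → swapped z ≡ μ z
    swapped-other {z} z≢u z≢x z≢y =
      trans (at z (transpose-other z≢y z≢x))
            (transpose-other (z≢u ∘ μ-injective) (z≢y ∘ μ-injective ∘ λ μz≡y → trans μz≡y (sym y-free)))

    swapped-cases : ∀ z → z ≡ u ⊎ z ≡ x ⊎ z ≡ y ⊎ swapped z ≡ μ z
    swapped-cases z = classify (z ≟ u) (z ≟ x) (z ≟ y)
      where
      classify : Dec (z ≡ u) → Dec (z ≡ x) → Dec (z ≡ y) →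
                 z ≡ u ⊎ z ≡ x ⊎ z ≡ y ⊎ swapped z ≡ μ z
      classify (yes z≡u) _         _         = inj₁ z≡u
      classify (no _)    (yes z≡x) _         = inj₂ (inj₁ z≡x)
      classify (no _)    (no _)    (yes z≡y) = inj₂ (inj₂ (inj₁ z≡y))
      classify (no z≢u)  (no z≢x)  (no z≢y)  = inj₂ (inj₂ (inj₂ (swapped-other z≢u z≢x z≢y)))

    swapped-fixed : ∀ z → swapped z ≡ z → z ≡ x ⊎ (μ z ≡ z × z ≢ y)
    swapped-fixed z fixed with swapped-cases z
    ... | inj₁ refl               = contradiction (trans (sym swapped-u) fixed) (u≢y ∘ sym)
    ... | inj₂ (inj₁ z≡x)         = inj₁ z≡x
    ... | inj₂ (inj₂ (inj₁ refl)) = contradiction (trans (sym swapped-y) fixed) u≢y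
    ... | inj₂ (inj₂ (inj₂ e))    =
      inj₂ (trans (sym e) fixed , λ { refl → u≢y (trans (sym swapped-y) fixed) })

    swapped-isMax : IsMaximalInvolution swapped
    swapped-isMax = record
      { involutive  = conjugate-involutive {σ = μ} x y involutive
      ; adjacent    = adjacent′
      ; independent = independent′
      }
      where
      adjacent′ : ∀ z → swapped z ≢ z → adj X z (swapped z) ≡ true
      adjacent′ z moved with swapped-cases z
      ... | inj₁ refl               = subst (λ w → adj X u w ≡ true) (sym swapped-u) u~y
      ... | inj₂ (inj₁ refl)        = contradiction swapped-x moved
      ... | inj₂ (inj₂ (inj₁ refl)) =
        subst (λ w → adj X y w ≡ true) (sym swapped-y) (trans (adjSym X y u) u~y)
      ... | inj₂ (inj₂ (inj₂ e))    = subst (λ w → adj X z w ≡ true) (sym e) (adjacent z (moved ∘ trans e))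

      independent′ : ∀ v w → swapped v ≡ v → swapped w ≡ w → adj X v w ≡ false
      independent′ v w v-free w-free with swapped-fixed v v-free | swapped-fixed w w-free
      ... | inj₁ refl       | inj₁ refl       = irrefl X x
      ... | inj₁ refl       | inj₂ (μw≡w , w≢y) = mate-isolated w μw≡w w≢y
      ... | inj₂ (μv≡v , v≢y) | inj₁ refl     = trans (adjSym X v x) (mate-isolated v μv≡v v≢y)
      ... | inj₂ (μv≡v , _) | inj₂ (μw≡w , _) = independent v w μv≡v μw≡w

    private
      lost-edge : ∀ a b → edgesOf μ a b ≡ true → edgesOf swapped a b ≡ false →
                  (a ≡ u × b ≡ x) ⊎ (a ≡ x × b ≡ u)
      lost-edge a b e₁ e₂ with edgesOf-true μ e₁ | swapped-cases a
      ... | refl , _    | inj₁ refl               = inj₁ (refl , refl)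
      ... | refl , _    | inj₂ (inj₁ refl)        = inj₂ (refl , involutive u)
      ... | refl , a≢μa | inj₂ (inj₂ (inj₁ refl)) = contradiction (sym y-free) a≢μa
      ... | refl , a≢μa | inj₂ (inj₂ (inj₂ e))    =
        contradiction (trans (sym (edgesOf-intro swapped e a≢μa)) e₂) true≢false

      gained-edge : ∀ a b → edgesOf swapped a b ≡ true → edgesOf μ a b ≡ false →
                    (a ≡ u × b ≡ y) ⊎ (a ≡ y × b ≡ u)
      gained-edge a b e₁ e₂ with edgesOf-true swapped e₁ | swapped-cases a
      ... | refl , _    | inj₁ refl               = inj₁ (refl , swapped-u)
      ... | refl , a≢sa | inj₂ (inj₁ refl)        = contradiction (sym swapped-x) a≢sa
      ... | refl , _    | inj₂ (inj₂ (inj₁ refl)) = inj₂ (refl , swapped-y)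
      ... | refl , a≢sa | inj₂ (inj₂ (inj₂ e))    =
        contradiction (trans (sym (edgesOf-intro μ (sym e) a≢sa)) e₂) true≢false

    forced : ∀ S → IsGlobalForcingSet X S → S u x ≡ true ⊎ S u y ≡ true
    forced S ((S-sym , _) , separates) with S u x in ux | S u y in uy
    ... | true  | _     = inj₁ refl
    ... | false | true  = inj₂ refl
    ... | false | false =
      ⊥-elim (separates (edgesOf μ) (edgesOf swapped) (edgesOf-maximal isMax) (edgesOf-maximal swapped-isMax)
                        differ (∩E-agrees {X} avoid-lost avoid-gained))
      where
      differ : ¬ SameEdges X (edgesOf μ) (edgesOf swapped)
      differ same = true≢false (trans (sym (mate isMax u-matched))
                      (trans (same u x) (edgesOf-false swapped (λ e → x≢y (trans (sym e) swapped-u)))))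

      avoid-lost : ∀ a b → edgesOf μ a b ≡ true → edgesOf swapped a b ≡ false → S a b ≡ false
      avoid-lost a b e₁ e₂ with lost-edge a b e₁ e₂
      ... | inj₁ (refl , refl) = ux
      ... | inj₂ (refl , refl) = trans (S-sym x u) ux

      avoid-gained : ∀ a b → edgesOf swapped a b ≡ true → edgesOf μ a b ≡ false → S a b ≡ false
      avoid-gained a b e₁ e₂ with gained-edge a b e₁ e₂
      ... | inj₁ (refl , refl) = uy
      ... | inj₂ (refl , refl) = trans (S-sym y u) uy

record IsPerfectInvolution (H : Graph) (p : Fin (n H) → Fin (n H)) : Set where
  field
    involutive : ∀ v → p (p v) ≡ v
    adjacent   : ∀ v → adj H v (p v) ≡ true

  adj⇒≢ : ∀ {v w} → adj H v w ≡ true → v ≢ w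
  adj⇒≢ {v} e refl = true≢false (trans (sym e) (irrefl H v))

  fixed-point-free : ∀ v → p v ≢ v
  fixed-point-free v = adj⇒≢ (adjacent v) ∘ sym

  injective : ∀ {v w} → p v ≡ p w → v ≡ w
  injective {v} {w} e = trans (sym (involutive v)) (trans (cong p e) (involutive w))

module Rotation {H : Graph} {p : Fin (n H) → Fin (n H)} (perfect : IsPerfectInvolution H p)
                (automorphism : ∀ v w → adj H (p v) (p w) ≡ adj H v w)
                {u x : Fin (n H)} (u~x : adj H u x ≡ true) where
  open IsPerfectInvolution perfect

  -- Trade the edges {u, p u} and {x, p x} of p for {u, x} and {p u, p x}.
  rotation : Fin (n H) → Fin (n H)
  rotation = conjugate p (p u) x

  private
    u≢x : u ≢ x
    u≢x = adj⇒≢ u~x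

    u≢pu : u ≢ p u
    u≢pu = fixed-point-free u ∘ sym

    px≢pu : p x ≢ p u
    px≢pu = u≢x ∘ sym ∘ injective

    px≢x : p x ≢ x
    px≢x = fixed-point-free x

    at : ∀ v {w} → transpose x (p u) v ≡ w → rotation v ≡ transpose (p u) x (p w)
    at _ = cong (transpose (p u) x ∘ p)

    pu~px : adj H (p u) (p x) ≡ true
    pu~px = trans (automorphism u x) u~x

  rotation-maps : rotation u ≡ x
  rotation-maps = trans (at u (transpose-other u≢x u≢pu)) (transpose-matchˡ (p u) x)

  rotation-perfect : IsPerfectInvolution H rotation
  rotation-perfect = record
    { involutive = conjugate-involutive {σ = p} (p u) x involutive
    ; adjacent   = λ v → by-cases v (v ≟ x) (v ≟ p u)
    }
    where
    adj-to : ∀ {v w} → rotation v ≡ w → adj H v w ≡ true → adj H v (rotation v) ≡ true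
    adj-to {v} e a = subst (λ w → adj H v w ≡ true) (sym e) a

    by-cases : ∀ v → Dec (v ≡ x) → Dec (v ≡ p u) → adj H v (rotation v) ≡ true
    by-cases v (yes refl) _ =
      adj-to (trans (at x (transpose-matchˡ x (p u)))
                    (trans (cong (transpose (p u) x) (involutive u)) (transpose-other u≢pu u≢x)))
             (trans (adjSym H x u) u~x)
    by-cases v (no _) (yes refl) =
      adj-to (trans (at (p u) (transpose-matchʳ x (p u))) (transpose-other px≢pu px≢x)) pu~px
    by-cases v (no v≢x) (no v≢pu) with transpose-other {i = x} {p u} v≢x v≢pu | p v ≟ p u | p v ≟ x
    ... | fixes | yes pv≡pu | _ rewrite injective pv≡pu =
      adj-to (trans (at u fixes) (transpose-matchˡ (p u) x)) u~x
    ... | fixes | no _ | yes pv≡x =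
      adj-to (trans (at v fixes) (trans (cong (transpose (p u) x) pv≡x) (transpose-matchʳ (p u) x)))
             (subst (λ w → adj H w (p u) ≡ true) (trans (cong p (sym pv≡x)) (involutive v))
                    (trans (adjSym H (p x) (p u)) pu~px))
    ... | fixes | no pv≢pu | no pv≢x =
      adj-to (trans (at v fixes) (transpose-other pv≢pu pv≢x)) (adjacent v)

-- The corona product

module Corona (G H : Graph) where

  private
    m = n H
    X = corona G H
    V = Fin (n X)

  coords : V → Fin (n G) × Fin (suc m)
  coords = remQuot {n G} (suc m)

  coords-combine : ∀ j t → coords (combine j t) ≡ (j , t)
  coords-combine = remQuot-combine

  combine-coords : ∀ {z j t} → coords z ≡ (j , t) → combine j t ≡ z
  combine-coords {z} e = trans (cong (uncurry combine) (sym e)) (combine-remQuot {n G} (suc m) z)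

  adj-combine : ∀ j t j' t' → adj X (combine j t) (combine j' t') ≡ coronaAdjPair G H (j , t) (j' , t')
  adj-combine j t j' t' = cong₂ (coronaAdjPair G H) (coords-combine j t) (coords-combine j' t')

  coronaAdj-copies : ∀ {j j'} s v → j ≢ j' → coronaAdjPair G H (j , s) (j' , suc v) ≡ false
  coronaAdj-copies {j} {j'} zero    v j≢j' = ⌊⌋-no (j ≟ j') j≢j'
  coronaAdj-copies {j} {j'} (suc u) v j≢j' rewrite ⌊⌋-no (j ≟ j') j≢j' = refl

  coronaAdj-hub : ∀ j v → coronaAdjPair G H (j , zero) (j , suc v) ≡ true
  coronaAdj-hub j v = ⌊⌋-yes (j ≟ j) refl

  coronaAdj-copy : ∀ j u v → coronaAdjPair G H (j , suc u) (j , suc v) ≡ adj H u v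
  coronaAdj-copy j u v rewrite ⌊⌋-yes (j ≟ j) refl = refl

  restrict : Rel X → Rel G
  restrict S j j' = S (combine j zero) (combine j' zero)

  coords-injective : ∀ {x y} → coords x ≡ coords y → x ≡ y
  coords-injective e = trans (sym (combine-coords refl)) (combine-coords (sym e))

  module Extension {p : Fin m → Fin m} (perfect : IsPerfectInvolution H p) where
    open IsPerfectInvolution perfect

    extendPair : Rel G → Fin (n G) × Fin (suc m) → Fin (n G) × Fin (suc m) → Bool
    extendPair M (j , zero)  (j' , zero)   = M j j'
    extendPair M (j , suc v) (j' , suc v') = ⌊ j ≟ j' ⌋ ∧ ⌊ p v ≟ v' ⌋
    extendPair M _           _             = false

    extend : Rel G → Rel X
    extend M x y = extendPair M (coords x) (coords y)

    extend-hub : ∀ M j j' → extend M (combine j zero) (combine j' zero) ≡ M j j'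
    extend-hub M j j' = cong₂ (extendPair M) (coords-combine j zero) (coords-combine j' zero)

    private
      copy-edge : ∀ {j j' : Fin (n G)} {v v'} →
                  ⌊ j ≟ j' ⌋ ∧ ⌊ p v ≟ v' ⌋ ≡ true → j ≡ j' × p v ≡ v'
      copy-edge {j} {j'} {v} {v'} e with ∧-true {⌊ j ≟ j' ⌋} e
      ... | e₁ , e₂ = ⌊⌋-true (j ≟ j') e₁ , ⌊⌋-true (p v ≟ v') e₂

      copy-edge-intro : ∀ (j : Fin (n G)) v → ⌊ j ≟ j ⌋ ∧ ⌊ p v ≟ p v ⌋ ≡ true
      copy-edge-intro j v rewrite ⌊⌋-yes (j ≟ j) refl | ⌊⌋-yes (p v ≟ p v) refl = refl

    module _ {M : Rel G} (M-maximal : IsMaximalMatching G M) where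
      private
        M-sym    = proj₁ (proj₁ (proj₁ M-maximal))
        M-edge   = proj₂ (proj₁ (proj₁ M-maximal))
        M-unique = proj₂ (proj₁ M-maximal)
        M-max    = proj₂ M-maximal

      extendPair-sym : ∀ a b → extendPair M a b ≡ extendPair M b a
      extendPair-sym (j , zero)  (j' , zero)   = M-sym j j'
      extendPair-sym (j , zero)  (j' , suc v') = refl
      extendPair-sym (j , suc v) (j' , zero)   = refl
      extendPair-sym (j , suc v) (j' , suc v') = ⇔→≡ (mk⇔ flip flip)
        where
        flip : ∀ {j j' : Fin (n G)} {v v'} →
               ⌊ j ≟ j' ⌋ ∧ ⌊ p v ≟ v' ⌋ ≡ true → ⌊ j' ≟ j ⌋ ∧ ⌊ p v' ≟ v ⌋ ≡ true
        flip {j} {v = v} e with copy-edge e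
        ... | refl , refl =
          subst (λ w → ⌊ j ≟ j ⌋ ∧ ⌊ p (p v) ≟ w ⌋ ≡ true) (involutive v) (copy-edge-intro j (p v))

      extendPair-edge : ∀ a b → extendPair M a b ≡ true → coronaAdjPair G H a b ≡ true
      extendPair-edge (j , zero)  (j' , zero)   e = M-edge j j' e
      extendPair-edge (j , suc v) (j' , suc v') e with copy-edge e
      ... | refl , refl = trans (coronaAdj-copy j v (p v)) (adjacent v)

      extendPair-unique : ∀ a b c → extendPair M a b ≡ true → extendPair M a c ≡ true → b ≡ c
      extendPair-unique (j , zero)  (j₁ , zero)   (j₂ , zero)   e₁ e₂ =
        cong (_, zero) (M-unique j j₁ j₂ e₁ e₂)
      extendPair-unique (j , suc v) (j₁ , suc v₁) (j₂ , suc v₂) e₁ e₂ with copy-edge e₁ | copy-edge e₂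
      ... | refl , refl | refl , refl = refl

      copy-or-hub : ∀ x → (Σ V λ z → extend M x z ≡ true) ⊎ (Σ (Fin (n G)) λ j → combine j zero ≡ x)
      copy-or-hub x with coords x in e
      ... | j , zero  = inj₂ (j , combine-coords e)
      ... | j , suc v = inj₁ (combine j (suc (p v)) , partner)
        where
        partner : extendPair M (j , suc v) (coords (combine j (suc (p v)))) ≡ true
        partner rewrite coords-combine j (suc (p v)) = copy-edge-intro j v

      extend-maximal : IsMaximalMatching X (extend M)
      extend-maximal = ((symmetric , edge) , unique) , maximal
        where
        symmetric : ∀ x y → extend M x y ≡ extend M y x
        symmetric x y = extendPair-sym (coords x) (coords y)

        edge : ∀ x y → extend M x y ≡ true → adj X x y ≡ true
        edge x y = extendPair-edge (coords x) (coords y)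

        unique : ∀ x y z → extend M x y ≡ true → extend M x z ≡ true → y ≡ z
        unique x y z e₁ e₂ = coords-injective (extendPair-unique (coords x) (coords y) (coords z) e₁ e₂)

        maximal : ∀ M' → IsMatching X M' → _⊆E_ {X} (extend M) M' → _⊆E_ {X} M' (extend M)
        maximal M' M'-matching@((M'-sym , M'-edge) , M'-unique) sub x y M'xy
          with copy-or-hub x | copy-or-hub y
        ... | inj₁ (z , e) | _ = ⊆E-matched {X} M'-matching sub e M'xy
        ... | inj₂ _ | inj₁ (z , e) =
          trans (symmetric x y) (⊆E-matched {X} M'-matching sub e (trans (M'-sym y x) M'xy))
        ... | inj₂ (j , refl) | inj₂ (j' , refl) =
          trans (extend-hub M j j') (M-max N N-matching M⊆N j j' M'xy)
          where
          N : Rel G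
          N = restrict M'

          N-matching : IsMatching G N
          N-matching = ((λ a b → M'-sym _ _) ,
                        (λ a b e → trans (sym (adj-combine a zero b zero)) (M'-edge _ _ e))) ,
                       (λ a b c e₁ e₂ → proj₁ (combine-injective b zero c zero (M'-unique _ _ _ e₁ e₂)))
          M⊆N : _⊆E_ {G} M N
          M⊆N a b e = sub _ _ (trans (extend-hub M a b) e)

    restrict-forcing : ∀ {S} → IsGlobalForcingSet X S → IsGlobalForcingSet G (restrict S)
    restrict-forcing {S} ((S-sym , S-edge) , separates) =
      ((λ j j' → S-sym _ _) , (λ j j' e → trans (sym (adj-combine j zero j' zero)) (S-edge _ _ e))) ,
      λ M₁ M₂ max₁ max₂ M₁≢M₂ same →
        separates (extend M₁) (extend M₂) (extend-maximal max₁) (extend-maximal max₂)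
          (λ same-ext → M₁≢M₂ λ j j' →
             trans (sym (extend-hub M₁ j j')) (trans (same-ext _ _) (extend-hub M₂ j j')))
          (traces-agree M₁ M₂ same)
      where
      traces-agree : ∀ M₁ M₂ → SameEdges G (_∩E_ {G} M₁ (restrict S)) (_∩E_ {G} M₂ (restrict S)) →
                     SameEdges X (_∩E_ {X} (extend M₁) S) (_∩E_ {X} (extend M₂) S)
      traces-agree M₁ M₂ same x y with coords x in ex | coords y in ey
      ... | j , zero  | j' , zero  = subst₂ (λ a b → M₁ j j' ∧ S a b ≡ M₂ j j' ∧ S a b)
                                            (combine-coords ex) (combine-coords ey) (same j j')
      ... | _ , zero  | _ , suc _  = refl
      ... | _ , suc _ | _ , zero   = refl
      ... | _ , suc _ | _ , suc _  = refl

  module Cone {q : Fin m → Fin m} (perfect : IsPerfectInvolution H q) (c : Fin m) where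
    open IsPerfectInvolution perfect
    open InvolutionMatching X

    -- The hub takes the place of c: it is matched to q c, the copy of c is left free.
    cone : Fin (suc m) → Fin (suc m)
    cone = conjugate (lift 1 q) zero (suc c)

    private
      qc≢c : q c ≢ c
      qc≢c = fixed-point-free c

      suc≢zero : ∀ {v : Fin m} → Fin.suc v ≢ zero
      suc≢zero = 0≢1+n ∘ sym

    cone-hub : cone zero ≡ suc (q c)
    cone-hub = trans (cong (transpose zero (suc c) ∘ lift 1 q) (transpose-matchʳ (suc c) zero))
                     (transpose-other suc≢zero (qc≢c ∘ suc-injective))

    cone-free : cone (suc c) ≡ suc c
    cone-free = trans (cong (transpose zero (suc c) ∘ lift 1 q) (transpose-matchˡ (suc c) zero))
                      (transpose-matchˡ zero (suc c))

    private
      cone-copy′ : ∀ {v} → v ≢ c → cone (suc v) ≡ transpose zero (suc c) (suc (q v))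
      cone-copy′ v≢c =
        cong (transpose zero (suc c) ∘ lift 1 q) (transpose-other (v≢c ∘ suc-injective) suc≢zero)

    cone-copy : ∀ {v} → v ≢ c → q v ≢ c → cone (suc v) ≡ suc (q v)
    cone-copy v≢c qv≢c = trans (cone-copy′ v≢c) (transpose-other suc≢zero (qv≢c ∘ suc-injective))

    cone-mate : ∀ {v} → q v ≡ c → cone (suc v) ≡ zero
    cone-mate {v} refl = trans (cone-copy′ (fixed-point-free v ∘ sym)) (transpose-matchʳ zero (suc (q v)))

    cone-fixed : ∀ {t} → cone t ≡ t → t ≡ suc c
    cone-fixed {t} fixed = begin
      t                                                  ≡⟨ transpose-inverse zero (suc c) ⟨
      transpose zero (suc c) (transpose (suc c) zero t)
        ≡⟨ cong (transpose zero (suc c)) (lift-fixed _ (conjugate-fixed {σ = lift 1 q} zero (suc c) fixed)) ⟩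
      transpose zero (suc c) zero                        ≡⟨ transpose-matchˡ zero (suc c) ⟩
      suc c                                              ∎
      where
      open ≡-Reasoning
      lift-fixed : ∀ w → lift 1 q w ≡ w → w ≡ zero
      lift-fixed zero    _ = refl
      lift-fixed (suc w) e = contradiction (suc-injective e) (fixed-point-free w)

    cone-adjacent : ∀ j t → cone t ≢ t → coronaAdjPair G H (j , t) (j , cone t) ≡ true
    cone-adjacent j zero _ =
      subst (λ s → coronaAdjPair G H (j , zero) (j , s) ≡ true) (sym cone-hub) (coronaAdj-hub j (q c))
    cone-adjacent j (suc v) moved = by-cases (v ≟ c) (q v ≟ c)
      where
      by-cases : Dec (v ≡ c) → Dec (q v ≡ c) → coronaAdjPair G H (j , suc v) (j , cone (suc v)) ≡ true
      by-cases (yes refl) _          = contradiction cone-free moved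
      by-cases (no _)     (yes qv≡c) = subst (λ s → coronaAdjPair G H (j , suc v) (j , s) ≡ true)
                                             (sym (cone-mate qv≡c)) (coronaAdj-hub j v)
      by-cases (no v≢c)   (no qv≢c)  = subst (λ s → coronaAdjPair G H (j , suc v) (j , s) ≡ true)
                                             (sym (cone-copy v≢c qv≢c))
                                             (trans (coronaAdj-copy j v (q v)) (adjacent v))

    coneMatching : V → V
    coneMatching z = combine (proj₁ (coords z)) (cone (proj₂ (coords z)))

    coneMatching-combine : ∀ j t → coneMatching (combine j t) ≡ combine j (cone t)
    coneMatching-combine j t =
      cong (λ (jt : Fin (n G) × Fin (suc m)) → combine (proj₁ jt) (cone (proj₂ jt))) (coords-combine j t)

    coneMatching-fixed : ∀ {z} → coneMatching z ≡ z → proj₂ (coords z) ≡ suc c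
    coneMatching-fixed {z} fixed =
      cone-fixed (proj₂ (combine-injective j (cone t) j t (trans fixed (sym (combine-coords refl)))))
      where
      j = proj₁ (coords z)
      t = proj₂ (coords z)

    coneMatching-isMax : IsMaximalInvolution coneMatching
    coneMatching-isMax = record
      { involutive  = involutive′
      ; adjacent    = adjacent′
      ; independent = independent′
      }
      where
      lift-involutive : ∀ t → lift 1 q (lift 1 q t) ≡ t
      lift-involutive zero    = refl
      lift-involutive (suc v) = cong suc (involutive v)

      involutive′ : ∀ z → coneMatching (coneMatching z) ≡ z
      involutive′ z = begin
        coneMatching (combine j (cone t))
          ≡⟨ coneMatching-combine j (cone t) ⟩
        combine j (cone (cone t))
          ≡⟨ cong (combine j) (conjugate-involutive {σ = lift 1 q} zero (suc c) lift-involutive t) ⟩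
        combine j t                       ≡⟨ combine-coords refl ⟩
        z                                 ∎
        where
        open ≡-Reasoning
        j = proj₁ (coords z)
        t = proj₂ (coords z)

      adjacent′ : ∀ z → coneMatching z ≢ z → adj X z (coneMatching z) ≡ true
      adjacent′ z moved =
        trans (cong (coronaAdjPair G H (coords z)) (coords-combine j (cone t)))
              (cone-adjacent j t λ fixed → moved (trans (cong (combine j) fixed) (combine-coords refl)))
        where
        j = proj₁ (coords z)
        t = proj₂ (coords z)

      independent′ : ∀ v w → coneMatching v ≡ v → coneMatching w ≡ w → adj X v w ≡ false
      independent′ v w v-free w-free
        rewrite coneMatching-fixed v-free | coneMatching-fixed w-free | irrefl H c = ∧-zeroʳ _

    cone-forced : ∀ {S} → IsGlobalForcingSet X S → ∀ i t → cone t ≢ t →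
                  coronaAdjPair G H (i , t) (i , suc c) ≡ true →
                  S (combine i t) (combine i (cone t)) ≡ true ⊎ S (combine i t) (combine i (suc c)) ≡ true
    cone-forced {S} forcing i t moved t~c =
      subst (λ w → S (combine i t) w ≡ true ⊎ _) (coneMatching-combine i t) (Swap.forced coneMatching-isMax
        {u = combine i t} {y = combine i (suc c)} u-matched y-free u~y mate-isolated S forcing)
      where
      u-matched : coneMatching (combine i t) ≢ combine i t
      u-matched e = moved (proj₂ (combine-injective i (cone t) i t (trans (sym (coneMatching-combine i t)) e)))

      y-free : coneMatching (combine i (suc c)) ≡ combine i (suc c)
      y-free = trans (coneMatching-combine i (suc c)) (cong (combine i) cone-free)

      u~y : adj X (combine i t) (combine i (suc c)) ≡ true
      u~y = trans (adj-combine i t i (suc c)) t~c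

      mate-isolated : ∀ w → coneMatching w ≡ w → w ≢ combine i (suc c) →
                      adj X (coneMatching (combine i t)) w ≡ false
      mate-isolated w w-free w≢y = begin
        adj X (coneMatching (combine i t)) w
          ≡⟨ cong (λ z → adj X z w) (coneMatching-combine i t) ⟩
        adj X (combine i (cone t)) w
          ≡⟨ cong₂ (coronaAdjPair G H) (coords-combine i (cone t)) w-coords ⟩
        coronaAdjPair G H (i , cone t) (j , suc c)
          ≡⟨ coronaAdj-copies (cone t) c i≢j ⟩
        false ∎
        where
        open ≡-Reasoning
        j = proj₁ (coords w)

        w-coords : coords w ≡ (j , suc c)
        w-coords = cong (j ,_) (coneMatching-fixed w-free)

        i≢j : i ≢ j
        i≢j refl = w≢y (sym (combine-coords w-coords))

  module _ {q : Fin m → Fin m} (perfect : IsPerfectInvolution H q) {S : Rel X} (forcing : IsGlobalForcingSet X S)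
           (i : Fin (n G)) where
    open IsPerfectInvolution perfect

    spoke-forced : ∀ c → S (combine i zero) (combine i (suc (q c))) ≡ true ⊎
                         S (combine i zero) (combine i (suc c)) ≡ true
    spoke-forced c = subst (λ s → S (combine i zero) (combine i s) ≡ true ⊎ _) cone-hub
      (cone-forced forcing i zero (λ e → 0≢1+n (trans (sym e) cone-hub)) (coronaAdj-hub i c))
      where open Cone perfect c

    copy-forced : ∀ {u y} → q u ≢ y → adj H u y ≡ true →
                  S (combine i (suc u)) (combine i (suc (q u))) ≡ true ⊎
                  S (combine i (suc u)) (combine i (suc y)) ≡ true
    copy-forced {u} {y} qu≢y u~y = subst (λ s → S (combine i (suc u)) (combine i s) ≡ true ⊎ _) cone-suc-u
      (cone-forced forcing i (suc u) (λ e → fixed-point-free u (suc-injective (trans (sym cone-suc-u) e)))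
                   (trans (coronaAdj-copy i u y) u~y))
      where
      open Cone perfect y
      cone-suc-u : cone (suc u) ≡ suc (q u)
      cone-suc-u = cone-copy (adj⇒≢ u~y) qu≢y

-- Counting

𝟙 : Bool → ℕ
𝟙 b = if b then 1 else 0

List-sum-allFin : ∀ n (f : Fin n → ℕ) → List.sum (map f (allFin n)) ≡ ∑[ i < n ] f i
List-sum-allFin n f = trans (cong List.sum (map-tabulate id f)) (sum-tabulate n f)
  where
  sum-tabulate : ∀ n (f : Fin n → ℕ) → List.sum (tabulate f) ≡ sum f
  sum-tabulate zero    f = refl
  sum-tabulate (suc n) f = cong (f zero +_) (sum-tabulate n (f ∘ suc))

∑-mono-≤ : ∀ {n} {f g : Fin n → ℕ} → (∀ i → f i ≤ g i) → sum f ≤ sum g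
∑-mono-≤ {zero}  _   = z≤n
∑-mono-≤ {suc n} f≤g = +-mono-≤ (f≤g zero) (∑-mono-≤ (f≤g ∘ suc))

term≤∑ : ∀ {n} (f : Fin n → ℕ) i → f i ≤ sum f
term≤∑ f zero    = m≤m+n (f zero) _
term≤∑ f (suc i) = ≤-trans (term≤∑ (f ∘ suc) i) (m≤n+m _ (f zero))

∑-const : ∀ n c → ∑[ i < n ] c ≡ n * c
∑-const zero    c = refl
∑-const (suc n) c = cong (c +_) (∑-const n c)

∑-↑ : ∀ m {n} (f : Fin (m + n) → ℕ) → sum f ≡ ∑[ i < m ] f (i ↑ˡ n) + ∑[ j < n ] f (m ↑ʳ j)
∑-↑ zero    f = refl
∑-↑ (suc m) f = trans (cong (f zero +_) (∑-↑ m (f ∘ suc))) (sym (+-assoc (f zero) _ _))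

∑-combine : ∀ m {n} (f : Fin (m * n) → ℕ) → sum f ≡ ∑[ i < m ] ∑[ j < n ] f (combine i j)
∑-combine zero    f = refl
∑-combine (suc m) {n} f =
  trans (∑-↑ n f) (cong (∑[ j < n ] f (combine {suc m} zero j) +_) (∑-combine m {n} (λ x → f (n ↑ʳ x))))

AtMostOneFailure : ∀ {n} → (Fin n → Bool) → (Fin n → Bool) → Set
AtMostOneFailure P f = ∀ x y → x ≢ y → P x ≡ true → P y ≡ true → f x ≡ true ⊎ f y ≡ true

AtMostOneFailure-suc : ∀ {n} {P f : Fin (suc n) → Bool} →
                       AtMostOneFailure P f → AtMostOneFailure (P ∘ suc) (f ∘ suc)
AtMostOneFailure-suc one-failure x y x≢y = one-failure (suc x) (suc y) (x≢y ∘ suc-injective)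

∑-all-but-one : ∀ {n} (P f : Fin n → Bool) → AtMostOneFailure P f →
                ∑[ x < n ] 𝟙 (P x) ≤ 1 + ∑[ x < n ] 𝟙 (P x ∧ f x)
∑-all-but-one {zero}  P f _ = z≤n
∑-all-but-one {suc n} P f one-failure with P zero in P₀ | f zero in f₀
... | false | _     = ∑-all-but-one (P ∘ suc) (f ∘ suc) (AtMostOneFailure-suc one-failure)
... | true  | true  = s≤s (∑-all-but-one (P ∘ suc) (f ∘ suc) (AtMostOneFailure-suc one-failure))
... | true  | false = s≤s (≤-reflexive (sum-cong-≗ rest-holds))
  where
  rest-holds : ∀ x → 𝟙 (P (suc x)) ≡ 𝟙 (P (suc x) ∧ f (suc x))
  rest-holds x with P (suc x) in Pₓ
  ... | false = refl
  ... | true with one-failure zero (suc x) (λ ()) P₀ Pₓ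
  ...   | inj₁ f₀-holds = contradiction (trans (sym f₀-holds) f₀) λ ()
  ...   | inj₂ fₓ-holds rewrite fₓ-holds = refl

-- The order of edgeCount, via _<ᵇ_ so that suc i ≺ suc j computes to i ≺ j.
_≺_ : ∀ {k} → Fin k → Fin k → Bool
i ≺ j = toℕ i <ᵇ toℕ j

edgeCount-∑ : ∀ X S → edgeCount X S ≡ ∑[ x < n X ] ∑[ y < n X ] 𝟙 (x ≺ y ∧ S x y)
edgeCount-∑ X S =
  trans (List-sum-allFin (n X) row) (sum-cong-≗ λ x →
    trans (List-sum-allFin (n X) (entry x)) (sum-cong-≗ λ y →
      cong (λ b → 𝟙 (b ∧ S x y)) (isYes≗does (toℕ x <? toℕ y))))
  where
  entry : Fin (n X) → Fin (n X) → ℕ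
  entry x y = 𝟙 (⌊ toℕ x <? toℕ y ⌋ ∧ S x y)

  row : Fin (n X) → ℕ
  row x = List.sum (map (entry x) (allFin (n X)))

<ᵇ-+ˡ : ∀ a m n → (a + m <ᵇ a + n) ≡ (m <ᵇ n)
<ᵇ-+ˡ zero    m n = refl
<ᵇ-+ˡ (suc a) m n = <ᵇ-+ˡ a m n

<ᵇ-*ˡ : ∀ k a b → (suc k * a <ᵇ suc k * b) ≡ (a <ᵇ b)
<ᵇ-*ˡ k zero    zero    rewrite *-zeroʳ k = refl
<ᵇ-*ˡ k zero    (suc b) rewrite *-zeroʳ k = refl
<ᵇ-*ˡ k (suc a) zero    rewrite *-zeroʳ k = refl
<ᵇ-*ˡ k (suc a) (suc b) = begin
  (suc k * suc a <ᵇ suc k * suc b)           ≡⟨ cong₂ _<ᵇ_ (*-suc (suc k) a) (*-suc (suc k) b) ⟩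
  (suc k + suc k * a <ᵇ suc k + suc k * b)   ≡⟨ <ᵇ-+ˡ (suc k) _ _ ⟩
  (suc k * a <ᵇ suc k * b)                   ≡⟨ <ᵇ-*ˡ k a b ⟩
  (a <ᵇ b)                                   ∎
  where open ≡-Reasoning

combine-≺-hub : ∀ {g k} (j j' : Fin g) → combine j (zero {k}) ≺ combine j' zero ≡ j ≺ j'
combine-≺-hub {k = k} j j'
  rewrite toℕ-combine j (zero {k}) | toℕ-combine j' (zero {k})
        | +-identityʳ (suc k * toℕ j) | +-identityʳ (suc k * toℕ j') = <ᵇ-*ˡ k (toℕ j) (toℕ j')

combine-≺-copy : ∀ {g k} (j : Fin g) (t t' : Fin k) → combine j t ≺ combine j t' ≡ t ≺ t'
combine-≺-copy {k = k} j t t' rewrite toℕ-combine j t | toℕ-combine j t' =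
  <ᵇ-+ˡ (k * toℕ j) (toℕ t) (toℕ t')

module CoronaCount (G H : Graph) (S : Rel (corona G H)) where
  open Corona G H using (restrict)

  private
    m = n H

    pair : Fin (n G) → Fin (suc m) → Fin (n G) → Fin (suc m) → ℕ
    pair j t j' t' = 𝟙 (combine j t ≺ combine j' t' ∧ S (combine j t) (combine j' t'))

    row : Fin (n G) → Fin (suc m) → ℕ
    row j t = ∑[ j' < n G ] ∑[ t' < suc m ] pair j t j' t'

  copyCount : Fin (n G) → ℕ
  copyCount i = ∑[ s < m ] 𝟙 (S (combine i zero) (combine i (suc s)))
              + ∑[ u < m ] ∑[ s < m ] 𝟙 (u ≺ s ∧ S (combine i (suc u)) (combine i (suc s)))

  private
    row-≥ : ∀ j t → ∑[ j' < n G ] pair j t j' zero + ∑[ s < m ] pair j t j (suc s) ≤ row j t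
    row-≥ j t = begin
      ∑[ j' < n G ] pair j t j' zero + ∑[ s < m ] pair j t j (suc s)
        ≤⟨ +-monoʳ-≤ _ (term≤∑ (λ j' → ∑[ s < m ] pair j t j' (suc s)) j) ⟩
      ∑[ j' < n G ] pair j t j' zero + ∑[ j' < n G ] ∑[ s < m ] pair j t j' (suc s)
        ≡⟨ ∑-distrib-+ (λ j' → pair j t j' zero) (λ j' → ∑[ s < m ] pair j t j' (suc s)) ⟨
      row j t ∎
      where open ≤-Reasoning

    copy-pairs : ∀ j → ∑[ s < m ] pair j zero j (suc s) + ∑[ u < m ] ∑[ s < m ] pair j (suc u) j (suc s)
                       ≡ copyCount j
    copy-pairs j = cong₂ _+_
      (sum-cong-≗ λ s → cong (λ b → 𝟙 (b ∧ S (combine j zero) (combine j (suc s))))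
                               (combine-≺-copy j zero (suc s)))
      (sum-cong-≗ λ u → sum-cong-≗ λ s →
        cong (λ b → 𝟙 (b ∧ S (combine j (suc u)) (combine j (suc s)))) (combine-≺-copy j (suc u) (suc s)))

    block-≥ : ∀ j → ∑[ j' < n G ] pair j zero j' zero + copyCount j ≤ ∑[ t < suc m ] row j t
    block-≥ j = begin
      A + copyCount j                ≡⟨ cong (A +_) (copy-pairs j) ⟨
      A + (B + C)                    ≡⟨ +-assoc A B C ⟨
      A + B + C                      ≤⟨ +-mono-≤ (row-≥ j zero)
                                                 (∑-mono-≤ λ u → ≤-trans (m≤n+m _ _) (row-≥ j (suc u))) ⟩
      ∑[ t < suc m ] row j t         ∎
      where
      open ≤-Reasoning
      A = ∑[ j' < n G ] pair j zero j' zero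
      B = ∑[ s < m ] pair j zero j (suc s)
      C = ∑[ u < m ] ∑[ s < m ] pair j (suc u) j (suc s)

    hub-pairs : ∑[ j < n G ] ∑[ j' < n G ] pair j zero j' zero ≡ edgeCount G (restrict S)
    hub-pairs = sym (trans (edgeCount-∑ G (restrict S))
      (sum-cong-≗ λ j → sum-cong-≗ λ j' →
        cong (λ b → 𝟙 (b ∧ restrict S j j')) (sym (combine-≺-hub j j'))))

    edgeCount-blocks : edgeCount (corona G H) S ≡ ∑[ j < n G ] ∑[ t < suc m ] row j t
    edgeCount-blocks = trans (edgeCount-∑ (corona G H) S)
      (trans (∑-combine (n G) {suc m} (λ x → ∑[ y < n (corona G H) ] 𝟙 (x ≺ y ∧ S x y)))
             (sum-cong-≗ λ (j : Fin (n G)) → sum-cong-≗ λ (t : Fin (suc m)) →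
               ∑-combine (n G) {suc m} (λ y → 𝟙 (combine j t ≺ y ∧ S (combine j t) y))))

  edgeCount-corona-≥ : edgeCount G (restrict S) + ∑[ i < n G ] copyCount i ≤ edgeCount (corona G H) S
  edgeCount-corona-≥ = begin
    edgeCount G (restrict S) + ∑[ i < n G ] copyCount i
      ≡⟨ cong (_+ ∑[ i < n G ] copyCount i) hub-pairs ⟨
    ∑[ j < n G ] ∑[ j' < n G ] pair j zero j' zero + ∑[ i < n G ] copyCount i
      ≡⟨ ∑-distrib-+ (λ j → ∑[ j' < n G ] pair j zero j' zero) copyCount ⟨
    ∑[ j < n G ] (∑[ j' < n G ] pair j zero j' zero + copyCount j)
      ≤⟨ ∑-mono-≤ block-≥ ⟩
    ∑[ j < n G ] ∑[ t < suc m ] row j t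
      ≡⟨ edgeCount-blocks ⟨
    edgeCount (corona G H) S ∎
    where open ≤-Reasoning

forwardDegree : (H : Graph) → Fin (n H) → ℕ
forwardDegree H u = ∑[ s < n H ] 𝟙 (u ≺ s ∧ adj H u s)

𝟙-∧-drop : ∀ a b c → 𝟙 ((a ∧ b) ∧ c) ≤ 𝟙 (a ∧ c)
𝟙-∧-drop true  true  c = ≤-refl
𝟙-∧-drop true  false c = z≤n
𝟙-∧-drop false b     c = z≤n

module _ {G H : Graph} {p : Fin (n H) → Fin (n H)} (perfect : IsPerfectInvolution H p)
         (automorphism : ∀ v w → adj H (p v) (p w) ≡ adj H v w)
         {S : Rel (corona G H)} (forcing : IsGlobalForcingSet (corona G H) S) (i : Fin (n G)) where
  open Corona G H
  open CoronaCount G H S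

  private
    copy : Fin (suc (n H)) → Fin (n (corona G H))
    copy = combine i

  unforced-at-most-once : ∀ {u x y} → x ≢ y → adj H u x ≡ true → adj H u y ≡ true →
                          S (copy (suc u)) (copy (suc x)) ≡ true ⊎ S (copy (suc u)) (copy (suc y)) ≡ true
  unforced-at-most-once {u} {x} {y} x≢y u~x u~y =
    subst (λ w → S (copy (suc u)) (copy (suc w)) ≡ true ⊎ _) rotation-maps
          (copy-forced rotation-perfect forcing i (λ e → x≢y (trans (sym rotation-maps) e)) u~y)
    where open Rotation perfect automorphism u~x

  copyCount-≥ : Fin (n H) → 1 + ∑[ u < n H ] (forwardDegree H u ∸ 1) ≤ copyCount i
  copyCount-≥ c = +-mono-≤ spokes (∑-mono-≤ inner)
    where
    spokes : 1 ≤ ∑[ s < n H ] 𝟙 (S (copy zero) (copy (suc s)))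
    spokes with spoke-forced perfect forcing i c
    ... | inj₁ e = subst (_≤ _) (cong 𝟙 e) (term≤∑ (λ s → 𝟙 (S (copy zero) (copy (suc s)))) (p c))
    ... | inj₂ e = subst (_≤ _) (cong 𝟙 e) (term≤∑ (λ s → 𝟙 (S (copy zero) (copy (suc s)))) c)

    inner : ∀ u → forwardDegree H u ∸ 1 ≤ ∑[ s < n H ] 𝟙 (u ≺ s ∧ S (copy (suc u)) (copy (suc s)))
    inner u = m≤n+o⇒m∸n≤o _ 1 (≤-trans (∑-all-but-one P f one-failure)
                                      (+-monoʳ-≤ 1 (∑-mono-≤ λ s → 𝟙-∧-drop (u ≺ s) (adj H u s) (f s))))
      where
      P f : Fin (n H) → Bool
      P s = u ≺ s ∧ adj H u s
      f s = S (copy (suc u)) (copy (suc s))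

      one-failure : AtMostOneFailure P f
      one-failure x y x≢y Px Py =
        unforced-at-most-once x≢y (proj₂ (∧-true {u ≺ x} Px)) (proj₂ (∧-true {u ≺ y} Py))

φgm-corona-≥ : ∀ G H {p} → IsPerfectInvolution H p → (∀ v w → adj H (p v) (p w) ≡ adj H v w) → Fin (n H) →
               ∀ a b → IsPhiGM G a → IsPhiGM (corona G H) b →
               a + nV G * (1 + ∑[ u < n H ] (forwardDegree H u ∸ 1)) ≤ b
φgm-corona-≥ G H perfect automorphism c a b (_ , a-minimal) ((S , forcing , |S|≡b) , _) = begin
  a + n G * d
    ≤⟨ +-mono-≤ (a-minimal (restrict S) (Extension.restrict-forcing perfect forcing))
                (≤-trans (≤-reflexive (sym (∑-const (n G) d)))
                         (∑-mono-≤ λ i → copyCount-≥ {G = G} perfect automorphism forcing i c)) ⟩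
  edgeCount G (restrict S) + ∑[ i < n G ] copyCount i   ≤⟨ edgeCount-corona-≥ ⟩
  edgeCount (corona G H) S                             ≡⟨ |S|≡b ⟩
  b                                                    ∎
  where
  open ≤-Reasoning
  open Corona G H using (restrict; module Extension)
  open CoronaCount G H S using (copyCount; edgeCount-corona-≥)
  d = 1 + ∑[ u < n H ] (forwardDegree H u ∸ 1)

-- Complete and complete bipartite graphs

halves-swap : ∀ {r t} k → r + suc t ≡ k + k → (r <ᵇ k) ≡ not (t <ᵇ k)
halves-swap {r} {t} k r+t+1≡k+k = by-cases (r <? k) (t <? k)
  where
  by-cases : (r? : Dec (r < k)) (t? : Dec (t < k)) → does r? ≡ not (does t?)
  by-cases (yes r<k) (yes t<k) =
    contradiction (subst (_≤ k + k) (cong suc r+t+1≡k+k) (+-mono-≤ r<k t<k)) (<-irrefl refl)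
  by-cases (yes _)   (no _)    = refl
  by-cases (no _)    (yes _)   = refl
  by-cases (no r≮k)  (no t≮k)  =
    contradiction (subst (_≤ k + k) (+-suc k k)
                         (subst (k + suc k ≤_) r+t+1≡k+k (+-mono-≤ (≮⇒≥ r≮k) (s≤s (≮⇒≥ t≮k)))))
                  (<-irrefl refl)

module Opposite {m} (k : ℕ) (m≡k+k : m ≡ k + k) where

  inLeftHalf : Fin m → Bool
  inLeftHalf v = toℕ v <ᵇ k

  opposite-halves : ∀ v → inLeftHalf (opposite v) ≡ not (inLeftHalf v)
  opposite-halves v = halves-swap k (begin
    toℕ (opposite v) + suc (toℕ v)   ≡⟨ cong (_+ suc (toℕ v)) (opposite-prop v) ⟩
    m ∸ suc (toℕ v) + suc (toℕ v)    ≡⟨ m∸n+n≡m (toℕ<n v) ⟩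
    m                                ≡⟨ m≡k+k ⟩
    k + k                            ∎)
    where open ≡-Reasoning

  opposite-fixed-point-free : ∀ v → opposite v ≢ v
  opposite-fixed-point-free v e =
    not-¬ {inLeftHalf v} refl (trans (sym (cong inLeftHalf e)) (opposite-halves v))

  opposite-injective : ∀ {v w : Fin m} → opposite v ≡ opposite w → v ≡ w
  opposite-injective {v} {w} e = trans (sym (opposite-involutive v)) (trans (cong opposite e) (opposite-involutive w))

module CompleteGraph (k : ℕ) where
  open Opposite k (cong (k +_) (+-identityʳ k))

  opposite-perfect : IsPerfectInvolution (K (2 * k)) opposite
  opposite-perfect = record
    { involutive = opposite-involutive
    ; adjacent   = λ v → cong not (⌊⌋-no (v ≟ opposite v) (opposite-fixed-point-free v ∘ sym))
    }

  opposite-automorphism : ∀ v w → adj (K (2 * k)) (opposite v) (opposite w) ≡ adj (K (2 * k)) v w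
  opposite-automorphism v w with v ≟ w
  ... | yes refl = cong not (⌊⌋-yes (opposite v ≟ opposite v) refl)
  ... | no v≢w   = cong not (⌊⌋-no (opposite v ≟ opposite w) (v≢w ∘ opposite-injective))

≺⇒≢ : ∀ {m} {u s : Fin m} → u ≺ s ≡ true → u ≢ s
≺⇒≢ {u = u} u≺s refl = contradiction (trans (sym u≺s) (dec-false (toℕ u <? toℕ u) (<-irrefl refl))) λ ()

forwardDegree-K : ∀ m u → forwardDegree (K m) u ≡ ∑[ s < m ] 𝟙 (u ≺ s)
forwardDegree-K m u = sum-cong-≗ λ s → cong 𝟙 (≢-redundant s)
  where
  ≢-redundant : ∀ s → (u ≺ s ∧ not ⌊ u ≟ s ⌋) ≡ u ≺ s
  ≢-redundant s with u ≺ s in u≺s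
  ... | false = refl
  ... | true  = cong not (⌊⌋-no (u ≟ s) (≺⇒≢ u≺s))

completeExcess : ℕ → ℕ
completeExcess m = ∑[ u < m ] (∑[ s < m ] 𝟙 (u ≺ s) ∸ 1)

completeExcess-suc : ∀ m → completeExcess (suc m) ≡ m ∸ 1 + completeExcess m
completeExcess-suc m = cong (λ d → d ∸ 1 + completeExcess m) (trans (∑-const m 1) (*-identityʳ m))

completeExcess-closed : ∀ m → completeExcess (suc (suc m)) * 2 ≡ m * suc m
completeExcess-closed zero    = refl
completeExcess-closed (suc m) = begin
  completeExcess (3 + m) * 2                  ≡⟨ cong (_* 2) (completeExcess-suc (2 + m)) ⟩
  (suc m + completeExcess (2 + m)) * 2        ≡⟨ *-distribʳ-+ 2 (suc m) _ ⟩
  suc m * 2 + completeExcess (2 + m) * 2      ≡⟨ cong (suc m * 2 +_) (completeExcess-closed m) ⟩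
  suc m * 2 + m * suc m                       ≡⟨ ring m ⟩
  suc m * suc (suc m)                         ∎
  where
  open ≡-Reasoning
  ring : ∀ m → suc m * 2 + m * suc m ≡ suc m * suc (suc m)
  ring = solve-∀

K-excess : ∀ j → let k = 2 + j in 2 * (k * k) ∸ 3 * k + 2 ≡ 1 + ∑[ u < 2 * k ] (forwardDegree (K (2 * k)) u ∸ 1)
K-excess j = begin
  2 * (k * k) ∸ 3 * k + 2    ≡⟨ cong (λ x → x ∸ 3 * k + 2) (ring₁ j) ⟩
  A + 3 * k ∸ 3 * k + 2      ≡⟨ cong (_+ 2) (m+n∸n≡m A (3 * k)) ⟩
  A + 2                      ≡⟨ +-suc A 1 ⟩
  1 + (A + 1)                ≡⟨ cong suc (*-cancelʳ-≡ (A + 1) (completeExcess (2 * k)) 2 excess-twice) ⟩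
  1 + completeExcess (2 * k) ≡⟨ cong suc (sum-cong-≗ λ u → cong (_∸ 1) (forwardDegree-K (2 * k) u)) ⟨
  1 + ∑[ u < 2 * k ] (forwardDegree (K (2 * k)) u ∸ 1) ∎
  where
  open ≡-Reasoning
  k = 2 + j
  -- A = 2k² − 3k, written in j to avoid truncated subtraction.
  A = 2 * (j * j) + 5 * j + 2

  ring₁ : ∀ j → 2 * ((2 + j) * (2 + j)) ≡ 2 * (j * j) + 5 * j + 2 + 3 * (2 + j)
  ring₁ = solve-∀
  ring₂ : ∀ j → 2 * (2 + j) ≡ suc (suc (2 * j + 2))
  ring₂ = solve-∀
  ring₃ : ∀ j → (2 * j + 2) * suc (2 * j + 2) ≡ (2 * (j * j) + 5 * j + 2 + 1) * 2
  ring₃ = solve-∀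

  excess-twice : (A + 1) * 2 ≡ completeExcess (2 * k) * 2
  excess-twice = sym (trans (cong (λ m → completeExcess m * 2) (ring₂ j))
                            (trans (completeExcess-closed (2 * j + 2)) (ring₃ j)))

module CompleteBipartiteGraph (k : ℕ) where
  open Opposite k refl

  adj-Kbip : ∀ v w → adj (Kbip k) v w ≡ inLeftHalf v xor inLeftHalf w
  adj-Kbip v w = cong₂ _xor_ (isYes≗does (toℕ v <? k)) (isYes≗does (toℕ w <? k))

  opposite-perfect : IsPerfectInvolution (Kbip k) opposite
  opposite-perfect = record
    { involutive = opposite-involutive
    ; adjacent   = λ v → begin
        adj (Kbip k) v (opposite v)                  ≡⟨ adj-Kbip v (opposite v) ⟩
        inLeftHalf v xor inLeftHalf (opposite v)     ≡⟨ cong (inLeftHalf v xor_) (opposite-halves v) ⟩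
        inLeftHalf v xor not (inLeftHalf v)          ≡⟨ not-distribʳ-xor (inLeftHalf v) (inLeftHalf v) ⟨
        not (inLeftHalf v xor inLeftHalf v)          ≡⟨ cong not (xor-same (inLeftHalf v)) ⟩
        true                                         ∎
    }
    where open ≡-Reasoning

  opposite-automorphism : ∀ v w → adj (Kbip k) (opposite v) (opposite w) ≡ adj (Kbip k) v w
  opposite-automorphism v w = begin
    adj (Kbip k) (opposite v) (opposite w)      ≡⟨ adj-Kbip (opposite v) (opposite w) ⟩
    inLeftHalf (opposite v) xor inLeftHalf (opposite w) ≡⟨ cong₂ _xor_ (opposite-halves v) (opposite-halves w) ⟩
    not a xor not b                             ≡⟨ not-distribˡ-xor a (not b) ⟨
    not (a xor not b)                           ≡⟨ cong not (not-distribʳ-xor a b) ⟨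
    not (not (a xor b))                         ≡⟨ not-involutive (a xor b) ⟩
    a xor b                                     ≡⟨ adj-Kbip v w ⟨
    adj (Kbip k) v w                            ∎
    where
    open ≡-Reasoning
    a = inLeftHalf v
    b = inLeftHalf w

  forwardDegree-left : ∀ (i : Fin k) → k ≤ forwardDegree (Kbip k) (i ↑ˡ k)
  forwardDegree-left i = begin
    k                                       ≡⟨ trans (sym (*-identityʳ k)) (sym (∑-const k 1)) ⟩
    ∑[ j < k ] 1                            ≡⟨ sum-cong-≗ (λ j → cong 𝟙 (forward-to-right j)) ⟨
    ∑[ j < k ] edge (k ↑ʳ j)                ≤⟨ m≤n+m _ _ ⟩
    ∑[ i' < k ] edge (i' ↑ˡ k) + ∑[ j < k ] edge (k ↑ʳ j) ≡⟨ ∑-↑ k edge ⟨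
    forwardDegree (Kbip k) (i ↑ˡ k)         ∎
    where
    open ≤-Reasoning
    u = i ↑ˡ k

    edge : Fin (k + k) → ℕ
    edge s = 𝟙 (u ≺ s ∧ adj (Kbip k) u s)

    forward-to-right : ∀ j → (u ≺ (k ↑ʳ j) ∧ adj (Kbip k) u (k ↑ʳ j)) ≡ true
    forward-to-right j = cong₂ _∧_ u≺ (trans (adj-Kbip u (k ↑ʳ j)) (cong₂ _xor_ u-left j-right))
      where
      u≺ : u ≺ (k ↑ʳ j) ≡ true
      u≺ = trans (cong₂ _<ᵇ_ (toℕ-↑ˡ i k) (toℕ-↑ʳ k j))
                 (dec-true (toℕ i <? k + toℕ j) (<-≤-trans (toℕ<n i) (m≤m+n k (toℕ j))))
      u-left : inLeftHalf u ≡ true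
      u-left = trans (cong (_<ᵇ k) (toℕ-↑ˡ i k)) (dec-true (toℕ i <? k) (toℕ<n i))
      j-right : inLeftHalf (k ↑ʳ j) ≡ false
      j-right = trans (cong (_<ᵇ k) (toℕ-↑ʳ k j)) (dec-false (k + toℕ j <? k) (m+n≮m k (toℕ j)))

  Kbip-excess : k * k ∸ k + 1 ≤ 1 + ∑[ u < k + k ] (forwardDegree (Kbip k) u ∸ 1)
  Kbip-excess = begin
    k * k ∸ k + 1                                         ≡⟨ +-comm _ 1 ⟩
    1 + (k * k ∸ k)                                       ≡⟨ cong (λ x → 1 + (k * k ∸ x)) (*-identityʳ k) ⟨
    1 + (k * k ∸ k * 1)                                   ≡⟨ cong (1 +_) (*-distribˡ-∸ k k 1) ⟨
    1 + k * (k ∸ 1)                                       ≡⟨ cong (1 +_) (∑-const k (k ∸ 1)) ⟨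
    1 + ∑[ i < k ] (k ∸ 1)                                ≤⟨ +-monoʳ-≤ 1 (∑-mono-≤ λ i → ∸-monoˡ-≤ 1 (forwardDegree-left i)) ⟩
    1 + ∑[ i < k ] excess (i ↑ˡ k)                        ≤⟨ +-monoʳ-≤ 1 (m≤m+n _ _) ⟩
    1 + (∑[ i < k ] excess (i ↑ˡ k) + ∑[ j < k ] excess (k ↑ʳ j)) ≡⟨ cong (1 +_) (∑-↑ k excess) ⟨
    1 + ∑[ u < k + k ] excess u                           ∎
    where
    open ≤-Reasoning
    excess : Fin (k + k) → ℕ
    excess u = forwardDegree (Kbip k) u ∸ 1

mainTheorem5 : (G : Graph) (k : ℕ) → 2 ≤ k →
    (∀ a b → IsPhiGM G a → IsPhiGM (corona G (K (2 * k))) b →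
    a + nV G * (2 * (k * k) ∸ 3 * k + 2) ≤ b) ×
    (∀ a b → IsPhiGM G a → IsPhiGM (corona G (Kbip k)) b →
    a + nV G * (k * k ∸ k + 1) ≤ b)
mainTheorem5 G k@(suc (suc j)) (s≤s (s≤s z≤n)) = complete , bipartite
  where
  complete : ∀ a b → IsPhiGM G a → IsPhiGM (corona G (K (2 * k))) b →
             a + nV G * (2 * (k * k) ∸ 3 * k + 2) ≤ b
  complete a b φ-G φ-X = subst (λ d → a + nV G * d ≤ b) (sym (K-excess j))
    (φgm-corona-≥ G (K (2 * k)) opposite-perfect opposite-automorphism zero a b φ-G φ-X)
    where open CompleteGraph k

  bipartite : ∀ a b → IsPhiGM G a → IsPhiGM (corona G (Kbip k)) b → a + nV G * (k * k ∸ k + 1) ≤ b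
  bipartite a b φ-G φ-X = ≤-trans (+-monoʳ-≤ a (*-monoʳ-≤ (nV G) Kbip-excess))
    (φgm-corona-≥ G (Kbip k) opposite-perfect opposite-automorphism zero a b φ-G φ-X)
    where open CompleteBipartiteGraph k
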